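{- Let $G$ be a graph with $m$ edges and $t \ge 2$. For each $T \in \mathcal{K}_t(G)$ let $\theta_G(T) = \max\{d_G(v) : v \in T\}$. Then \[ \sum_{T \in \mathcal{K}_t(G)} \frac{1}{\binom{\theta_G(T)-1}{t-2}} \le \frac{m}{\binom{t}{2}}. \] When $t \ge 3$, equality holds if and only if $G$ is a disjoint union of complete graphs of order at least $t$ and any number of isolated vertices.
   Context: $\mathcal{K}_t(G) = \{S \subseteq V(G) : G[S] \cong K_t\}$ is the set of vertex sets of $t$-cliques of $G$; $d_G(v)$ is the degree of $v$ in $G$. -}

module Defs where

open import Data.Bool using (Bool; true; false; if_then_else_; _∧_)
open import Data.Nat using (ℕ; zero; suc; _⊔_; _+_; _<_)
open import Data.Nat.Combinatorics using (_C_)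
open import Data.Fin using (Fin)
open import Data.Fin.Subset using (Subset; _∈_; ∣_∣)
open import Data.Vec using (Vec; []; _∷_; lookup)
open import Data.List using (List; []; _∷_; _++_; map; filter; foldr; allFin)
open import Data.Integer using (+_)
open import Data.Rational using (ℚ; 0ℚ; _/_) renaming (_+_ to _+ℚ_)
open import Data.Product using (Σ; _×_; _,_)
open import Data.Sum using (_⊎_)
open import Relation.Nullary using (¬_; Dec; yes; no)
open import Relation.Nullary.Decidable using (⌊_⌋)
open import Relation.Binary.PropositionalEquality using (_≡_; _≢_)
open import Function.Bundles using (_⇔_)

record Graph (n : ℕ) : Set where
  field
    adj    : Fin n → Fin n → Bool
    sym    : ∀ u v → adj u v ≡ adj v u
    irrefl : ∀ v → adj v v ≡ false
open Graph public

count : {A : Set} → (A → Bool) → List A → ℕ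
count p = foldr (λ x r → if p x then suc r else r) 0

deg : ∀ {n} → Graph n → Fin n → ℕ
deg G v = count (adj G v) (allFin _)


numEdges : ∀ {n} → Graph n → ℕ
numEdges {n} G = foldr _+_ 0 (map (λ u → count (λ v → ⌊ u Data.Fin.<? v ⌋ ∧ adj G u v) (allFin n)) (allFin n))

allSubsets : (n : ℕ) → List (Subset n)
allSubsets zero = [] ∷ []
allSubsets (suc n) = map (false ∷_) (allSubsets n) ++ map (true ∷_) (allSubsets n)

allV : ∀ {n} → (Fin n → Bool) → Bool
allV {n} p = foldr _∧_ true (map p (allFin n))

isCliqueSet : ∀ {n} → Graph n → Subset n → Bool
isCliqueSet G S =
  allV (λ u → allV (λ v →
    if lookup S u ∧ lookup S v ∧ Data.Bool.not ⌊ u Data.Fin.≟ v ⌋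
    then adj G u v else true))

-- 𝒦_t(G): vertex sets of t-cliques of G (G[S] ≅ K_t iff |S| = t and S is a clique)
cliques : ∀ {n} → Graph n → ℕ → List (Subset n)
cliques {n} G t =
  filter (λ S → Data.Bool._≟_ (isCliqueSet G S ∧ ⌊ ∣ S ∣ Data.Nat.≟ t ⌋) true) (allSubsets n)

theta : ∀ {n} → Graph n → Subset n → ℕ
theta {n} G T = foldr _⊔_ 0 (map (λ v → if lookup T v then deg G v else 0) (allFin n))

-- reciprocal 1/k in ℚ (convention 1/0 = 0; never used at 0 in the statement)
recip : ℕ → ℚ
recip zero = 0ℚ
recip (suc k) = + 1 / suc k

sumℚ : List ℚ → ℚ
sumℚ = foldr _+ℚ_ 0ℚ

cliqueSum : ∀ {n} → Graph n → ℕ → ℚ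
cliqueSum G t = sumℚ (map (λ T → recip ((theta G T Data.Nat.∸ 1) C (t Data.Nat.∸ 2))) (cliques G t))

edgeBound : ∀ {n} → Graph n → ℕ → ℚ
edgeBound G t = ((+ numEdges G) / 1) Data.Rational.* recip (t C 2)

-- G is a disjoint union of complete graphs of order ≥ t together with isolated vertices:
-- there is a labelling c of the vertices by components such that u ~ v iff u ≠ v and
-- c u = c v, and every component has either exactly one vertex (isolated vertex) or ≥ t.
componentSize : ∀ {n} → (Fin n → Fin n) → Fin n → ℕ
componentSize {n} c v = count (λ u → ⌊ c u Data.Fin.≟ c v ⌋) (allFin n)

IsUnionOfCliques : ∀ {n} → ℕ → Graph n → Set
IsUnionOfCliques {n} t G =
  Σ (Fin n → Fin n) λ c →
    (∀ u v → (adj G u v ≡ true) ⇔ ((u ≢ v) × (c u ≡ c v)))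
    × (∀ v → (componentSize c v ≡ 1) ⊎ (t Data.Nat.≤ componentSize c v))

module Submission where

-- Weight each t-clique T by 1 / C(θ(T) - 1, t - 2). Counting the pairs (edge ab, t-clique T ∋ a, b) gives
-- C(t, 2) · Σ_T weight(T) = Σ_{ab edge} load(ab), where load(ab) is the total weight of the t-cliques through ab.
-- Such a clique lies between {a, b} and the closed neighbourhood N[a], so there are at most C(d(a) - 1, t - 2) of
-- them, and each has θ(T) ≥ d(a); hence load(ab) ≤ 1, which is the inequality. Equality forces load(ab) = 1 on
-- every edge: then every t-subset of N[a] containing a and b is a clique, so for t ≥ 3 adjacent vertices have equal
-- closed neighbourhoods and the components are cliques of order at least t. Conversely, in a disjoint union of such
-- cliques every load is exactly 1.

open import Algebra.Bundles using (module CommutativeMonoid)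
open import Data.Bool using (Bool; true; false; if_then_else_; _∧_; _∨_; not)
import Data.Bool as Bool
open import Data.Bool.Properties using (∧-zeroʳ; ∧-identityʳ; ∧-comm; if-eta)
open import Data.Empty using (⊥-elim)
open import Data.Fin using (Fin; zero; suc)
import Data.Fin as Fin
open import Data.Fin.Properties using (<-cmp; <⇒≢)
open import Data.Fin.Subset using (Subset; ∣_∣; ⁅_⁆)
open import Data.Fin.Subset.Properties using (∣⁅x⁆∣≡1; x∈⁅x⁆; x∈⁅y⁆⇒x≡y)
import Data.Integer as ℤ
import Data.Integer.Properties as ℤ
open import Data.List using (List; []; _∷_; _++_; map; foldr; filter; allFin; findᵇ)
open import Data.List.Properties using (map-tabulate; tabulate-cong)
open import Data.List.Relation.Unary.Any using (here; there)
open import Data.List.Membership.Propositional using (_∈_)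
open import Data.List.Membership.Propositional.Properties using (∈-allFin; ∈-++⁺ˡ; ∈-++⁺ʳ; ∈-map⁺)
open import Data.Maybe using (just; fromMaybe)
open import Data.Maybe.Properties using (just-injective)
open import Data.Nat as ℕ using (ℕ; zero; suc; z≤n; s≤s; _+_; _∸_; _≤_; _<_; _⊔_)
open import Data.Nat.Combinatorics using (_C_; nCk+nC[k+1]≡[n+1]C[k+1]; nC1≡n; k>n⇒nCk≡0)
open import Data.Nat.Coprimality using (1-coprimeTo) renaming (sym to coprime-sym)
open import Data.Nat.Properties
  using (≤-refl; ≤-trans; ≤-antisym; ≤-reflexive; <-irrefl; ≰⇒>; suc-injective; n≤1+n; m≤n⇒m≤1+n; n≤0⇒n≡0;
         m≤m+n; +-suc; +-identityʳ; +-comm; +-mono-≤; +-monoˡ-≤; +-∸-assoc; m∸n+n≡m; ∸-monoˡ-≤;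
         m≤m⊔n; m≤n⊔m; ⊔-lub; +-commutativeSemigroup; module ≤-Reasoning)
open import Data.Product using (Σ; Σ-syntax; _×_; _,_; proj₁; proj₂)
open import Data.Rational using (ℚ; mkℚ; 0ℚ; 1ℚ; _/_; ↥_; *≤*; nonNegative)
  renaming (_+_ to _+ℚ_; _*_ to _*ℚ_; _≤_ to _≤ℚ_)
import Data.Rational.Properties as ℚ
open import Data.Sum using (_⊎_; inj₁; inj₂)
open import Data.Vec using ([]; _∷_; lookup; tabulate; _[_]≔_)
open import Data.Vec.Properties using (lookup∘tabulate; lookup∘update; lookup∘update′; []=⇒lookup; lookup⇒[]=)
open import Function using (_∘_; id)
open import Function.Bundles using (_⇔_; mk⇔; Equivalence)
open import Function.Construct.Symmetry using (⇔-sym)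
open import Function.Properties.Equivalence using (⇔-setoid)
open import Level using (0ℓ)
open import Relation.Binary.Definitions using (tri<; tri≈; tri>)
open import Relation.Binary.PropositionalEquality
import Relation.Binary.Reasoning.Setoid as SetoidReasoning
open import Relation.Nullary using (Dec; yes; no; ¬_; does)
open import Relation.Nullary.Decidable using (⌊_⌋; ⌊⌋-map′; isYes≗does; dec-true; dec-false)
open import Relation.Unary using (Decidable)
open import Algebra.Properties.CommutativeSemigroup +-commutativeSemigroup using (x∙yz≈y∙xz)
open import Algebra.Properties.CommutativeSemigroup
  (CommutativeMonoid.commutativeSemigroup ℚ.+-0-commutativeMonoid) using (interchange)
open import Defs hiding (sym)

private variable A B : Set

∧-elimˡ : ∀ x {y} → x ∧ y ≡ true → x ≡ true
∧-elimˡ true _ = refl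

∧-elimʳ : ∀ x {y} → x ∧ y ≡ true → y ≡ true
∧-elimʳ true eq = eq

∧-intro : ∀ {x y} → x ≡ true → y ≡ true → x ∧ y ≡ true
∧-intro refl refl = refl

≡-by-⇔ : ∀ {x y} → (x ≡ true → y ≡ true) → (y ≡ true → x ≡ true) → x ≡ y
≡-by-⇔ {true}  {true}  _ _ = refl
≡-by-⇔ {false} {false} _ _ = refl
≡-by-⇔ {true}  {false} x⇒y _ = sym (x⇒y refl)
≡-by-⇔ {false} {true}  _ y⇒x = y⇒x refl

⌊⌋-true : ∀ {P : Set} (P? : Dec P) → P → ⌊ P? ⌋ ≡ true
⌊⌋-true P? p = trans (isYes≗does P?) (dec-true P? p)

⌊⌋-false : ∀ {P : Set} (P? : Dec P) → ¬ P → ⌊ P? ⌋ ≡ false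
⌊⌋-false P? ¬p = trans (isYes≗does P?) (dec-false P? ¬p)

⌊⌋-true⁻ : ∀ {P : Set} (P? : Dec P) → ⌊ P? ⌋ ≡ true → P
⌊⌋-true⁻ (yes p) _ = p

⌊suc≟suc⌋ : ∀ m n → ⌊ suc m ℕ.≟ suc n ⌋ ≡ ⌊ m ℕ.≟ n ⌋
⌊suc≟suc⌋ m n = trans (isYes≗does (suc m ℕ.≟ suc n)) (sym (isYes≗does (m ℕ.≟ n)))

⌊suc<?suc⌋ : ∀ {n} (u v : Fin n) → ⌊ suc u Fin.<? suc v ⌋ ≡ ⌊ u Fin.<? v ⌋
⌊suc<?suc⌋ u v = trans (isYes≗does (suc u Fin.<? suc v)) (sym (isYes≗does (u Fin.<? v)))

does-≟-true : ∀ b → does (b Bool.≟ true) ≡ b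
does-≟-true true  = refl
does-≟-true false = refl

count-∷ : (p : A → Bool) (x : A) (xs : List A) → count p (x ∷ xs) ≡ (if p x then 1 else 0) + count p xs
count-∷ p x xs with p x
... | true  = refl
... | false = refl

count-cong : (xs : List A) {p q : A → Bool} → (∀ x → p x ≡ q x) → count p xs ≡ count q xs
count-cong []       p≗q = refl
count-cong (x ∷ xs) p≗q rewrite p≗q x | count-cong xs p≗q = refl

count-false : (xs : List A) → count (λ _ → false) xs ≡ 0
count-false []       = refl
count-false (_ ∷ xs) = count-false xs

count-none : (p : A → Bool) (xs : List A) → (∀ x → p x ≡ false) → count p xs ≡ 0
count-none p xs none = trans (count-cong xs none) (count-false xs)

count-map : (p : B → Bool) (f : A → B) (xs : List A) → count p (map f xs) ≡ count (p ∘ f) xs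
count-map p f []       = refl
count-map p f (x ∷ xs) with p (f x)
... | true  = cong suc (count-map p f xs)
... | false = count-map p f xs

count-++ : (p : A → Bool) (xs ys : List A) → count p (xs ++ ys) ≡ count p xs + count p ys
count-++ p []       ys = refl
count-++ p (x ∷ xs) ys with p x
... | true  = cong suc (count-++ p xs ys)
... | false = count-++ p xs ys

module _ {p q : A → Bool} (p⇒q : ∀ x → p x ≡ true → q x ≡ true) where

  count-mono : (xs : List A) → count p xs ≤ count q xs
  count-mono []       = z≤n
  count-mono (x ∷ xs) with p x in px | q x in qx | p⇒q x
  ... | true  | true  | _ = s≤s (count-mono xs)
  ... | false | true  | _ = m≤n⇒m≤1+n (count-mono xs)
  ... | false | false | _ = count-mono xs
  ... | true  | false | f with f refl
  ...   | ()

  count-mono-equality : (xs : List A) → count p xs ≡ count q xs → ∀ x → x ∈ xs → q x ≡ true → p x ≡ true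
  count-mono-equality (y ∷ xs) eq x x∈ qx with p y in py | q y in qy | p⇒q y
  count-mono-equality (y ∷ xs) eq x (here refl)  qx | true  | true  | _ = py
  count-mono-equality (y ∷ xs) eq x (there x∈xs) qx | true  | true  | _ =
    count-mono-equality xs (suc-injective eq) x x∈xs qx
  count-mono-equality (y ∷ xs) eq x (here refl)  qx | false | false | _ = trans py (trans (sym qy) qx)
  count-mono-equality (y ∷ xs) eq x (there x∈xs) qx | false | false | _ =
    count-mono-equality xs eq x x∈xs qx
  count-mono-equality (y ∷ xs) eq x x∈ qx | false | true | _ =
    ⊥-elim (<-irrefl eq (s≤s (count-mono xs)))
  count-mono-equality (y ∷ xs) eq x x∈ qx | true | false | f with f refl
  ... | ()

count-pos : (p : A → Bool) (xs : List A) → 0 < count p xs → Σ[ x ∈ A ] (x ∈ xs × p x ≡ true)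
count-pos p (x ∷ xs) pos with p x in px
... | true  = x , here refl , px
... | false with count-pos p xs pos
...   | y , y∈xs , py = y , there y∈xs , py

count-zero : (p : A → Bool) (xs : List A) → count p xs ≡ 0 → ∀ x → x ∈ xs → p x ≡ false
count-zero p (y ∷ xs) eq x x∈ with p y in py
count-zero p (y ∷ xs) () x x∈           | true
count-zero p (y ∷ xs) eq x (here refl)  | false = py
count-zero p (y ∷ xs) eq x (there x∈xs) | false = count-zero p xs eq x x∈xs

count-allFin-suc : ∀ {n} (p : Fin (suc n) → Bool) →
                   count p (allFin (suc n)) ≡ (if p zero then 1 else 0) + count (p ∘ suc) (allFin n)
count-allFin-suc {n} p = begin
  count p (allFin (suc n))
    ≡⟨ cong (λ is → count p (zero ∷ is)) (sym (map-tabulate id suc)) ⟩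
  count p (zero ∷ map suc (allFin n))
    ≡⟨ count-∷ p zero (map suc (allFin n)) ⟩
  (if p zero then 1 else 0) + count p (map suc (allFin n))
    ≡⟨ cong ((if p zero then 1 else 0) +_) (count-map p suc (allFin n)) ⟩
  (if p zero then 1 else 0) + count (p ∘ suc) (allFin n) ∎
  where open ≡-Reasoning

count-allFin-remove : ∀ {n} (p : Fin n → Bool) (b : Fin n) →
  count p (allFin n) ≡ (if p b then 1 else 0) + count (λ i → p i ∧ not ⌊ i Fin.≟ b ⌋) (allFin n)
count-allFin-remove {suc n} p zero
  rewrite count-allFin-suc p | count-allFin-suc (λ i → p i ∧ not ⌊ i Fin.≟ zero ⌋) | ∧-zeroʳ (p zero) =
  cong ((if p zero then 1 else 0) +_) (count-cong (allFin n) (λ i → sym (∧-identityʳ (p (suc i)))))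
count-allFin-remove {suc n} p (suc b)
  rewrite count-allFin-suc p | count-allFin-suc (λ i → p i ∧ not ⌊ i Fin.≟ suc b ⌋) | ∧-identityʳ (p zero)
        | count-allFin-remove (p ∘ suc) b =
  trans (x∙yz≈y∙xz (if p zero then 1 else 0) (if p (suc b) then 1 else 0) _)
        (cong (λ c → (if p (suc b) then 1 else 0) + ((if p zero then 1 else 0) + c))
              (count-cong (allFin n) (λ i → cong (λ d → p (suc i) ∧ not d) (sym (⌊⌋-map′ _ _ (i Fin.≟ b))))))

findᵇ-cong : (xs : List A) {p q : A → Bool} → (∀ x → p x ≡ q x) → findᵇ p xs ≡ findᵇ q xs
findᵇ-cong []       p≗q = refl
findᵇ-cong (x ∷ xs) p≗q rewrite p≗q x | findᵇ-cong xs p≗q = refl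

findᵇ-just : (p : A → Bool) (xs : List A) {y : A} → findᵇ p xs ≡ just y → p y ≡ true
findᵇ-just p (x ∷ xs) found with p x in px
findᵇ-just p (x ∷ xs) refl  | true  = px
findᵇ-just p (x ∷ xs) found | false = findᵇ-just p xs found

findᵇ-∈ : (p : A → Bool) {xs : List A} {x : A} → x ∈ xs → p x ≡ true → Σ[ y ∈ A ] findᵇ p xs ≡ just y
findᵇ-∈ p {y ∷ xs} x∈ px with p y in py
... | true = y , refl
findᵇ-∈ p {y ∷ xs} (here refl)  px | false with () ← trans (sym px) py
findᵇ-∈ p {y ∷ xs} (there x∈xs) px | false = findᵇ-∈ p x∈xs px

all-sound : (p : A → Bool) (xs : List A) → foldr _∧_ true (map p xs) ≡ true → ∀ x → x ∈ xs → p x ≡ true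
all-sound p (y ∷ xs) all x (here refl)  = ∧-elimˡ (p y) all
all-sound p (y ∷ xs) all x (there x∈xs) = all-sound p xs (∧-elimʳ (p y) all) x x∈xs

all-complete : (p : A → Bool) (xs : List A) → (∀ x → p x ≡ true) → foldr _∧_ true (map p xs) ≡ true
all-complete p []       _   = refl
all-complete p (y ∷ xs) all = ∧-intro (all y) (all-complete p xs all)

≤-foldr-⊔ : (f : A → ℕ) (xs : List A) → ∀ x → x ∈ xs → f x ≤ foldr _⊔_ 0 (map f xs)
≤-foldr-⊔ f (y ∷ xs) x (here refl)  = m≤m⊔n (f y) _
≤-foldr-⊔ f (y ∷ xs) x (there x∈xs) = ≤-trans (≤-foldr-⊔ f xs x x∈xs) (m≤n⊔m (f y) _)

foldr-⊔-≤ : (f : A → ℕ) (xs : List A) {d : ℕ} → (∀ x → f x ≤ d) → foldr _⊔_ 0 (map f xs) ≤ d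
foldr-⊔-≤ f []       f≤d = z≤n
foldr-⊔-≤ f (y ∷ xs) f≤d = ⊔-lub (f≤d y) (foldr-⊔-≤ f xs f≤d)

pascal : ∀ n k → suc n C suc k ≡ n C k + n C suc k
pascal n k = sym (nCk+nC[k+1]≡[n+1]C[k+1] n k)

C-monoˡ-≤ : ∀ {m n} k → m ≤ n → m C k ≤ n C k
C-monoˡ-≤                 zero    _         = ≤-refl
C-monoˡ-≤ {zero}          (suc k) _         = z≤n
C-monoˡ-≤ {suc m} {suc n} (suc k) (s≤s m≤n) rewrite pascal m k | pascal n k =
  +-mono-≤ (C-monoˡ-≤ k m≤n) (C-monoˡ-≤ (suc k) m≤n)

C-pos : ∀ {n k} → k ≤ n → 0 < n C k
C-pos {n}     {zero}  _         = s≤s z≤n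
C-pos {suc n} {suc k} (s≤s k≤n) rewrite pascal n k = ≤-trans (C-pos k≤n) (m≤m+n _ _)

C-pos⁻ : ∀ {n k} → 0 < n C k → k ≤ n
C-pos⁻ {n} {k} 0<nCk with k ℕ.≤? n
... | yes k≤n = k≤n
... | no  k≰n = ⊥-elim (<-irrefl (sym (k>n⇒nCk≡0 (≰⇒> k≰n))) 0<nCk)

-- As in Defs, membership is read off with lookup; _⊆ᵇ_ decides _⊆_ so that subsets can be counted.

infix 4 _⊆_
infix 7 _⊆ᵇ_

record _⊆_ {n} (S T : Subset n) : Set where
  constructor mk⊆
  field ⊆-lookup : ∀ i → lookup S i ≡ true → lookup T i ≡ true
open _⊆_ public

_⊆ᵇ_ : ∀ {n} → Subset n → Subset n → Bool
[]      ⊆ᵇ []      = true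
(x ∷ S) ⊆ᵇ (y ∷ T) = (not x ∨ y) ∧ (S ⊆ᵇ T)

⊆ᵇ⇒⊆ : ∀ {n} (S T : Subset n) → S ⊆ᵇ T ≡ true → S ⊆ T
⊆ᵇ⇒⊆ S T S⊆T = mk⊆ (lookup-⊆ S T S⊆T)
  where
  lookup-⊆ : ∀ {n} (S T : Subset n) → S ⊆ᵇ T ≡ true → ∀ i → lookup S i ≡ true → lookup T i ≡ true
  lookup-⊆ (true ∷ S) (true ∷ T) _   zero    _   = refl
  lookup-⊆ (x    ∷ S) (y    ∷ T) S⊆T (suc i) i∈S = lookup-⊆ S T (∧-elimʳ (not x ∨ y) S⊆T) i i∈S

⊆⇒⊆ᵇ : ∀ {n} (S T : Subset n) → S ⊆ T → S ⊆ᵇ T ≡ true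
⊆⇒⊆ᵇ []          []          _         = refl
⊆⇒⊆ᵇ (true  ∷ S) (true  ∷ T) (mk⊆ S⊆T) = ⊆⇒⊆ᵇ S T (mk⊆ (S⊆T ∘ suc))
⊆⇒⊆ᵇ (false ∷ S) (y     ∷ T) (mk⊆ S⊆T) = ⊆⇒⊆ᵇ S T (mk⊆ (S⊆T ∘ suc))
⊆⇒⊆ᵇ (true  ∷ S) (false ∷ T) (mk⊆ S⊆T) with S⊆T zero refl
... | ()

⊆ᵇ⇒∣∣≤ : ∀ {n} (S T : Subset n) → S ⊆ᵇ T ≡ true → ∣ S ∣ ≤ ∣ T ∣
⊆ᵇ⇒∣∣≤ []          []          _   = z≤n
⊆ᵇ⇒∣∣≤ (true  ∷ S) (true  ∷ T) S⊆T = s≤s (⊆ᵇ⇒∣∣≤ S T S⊆T)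
⊆ᵇ⇒∣∣≤ (false ∷ S) (true  ∷ T) S⊆T = m≤n⇒m≤1+n (⊆ᵇ⇒∣∣≤ S T S⊆T)
⊆ᵇ⇒∣∣≤ (false ∷ S) (false ∷ T) S⊆T = ⊆ᵇ⇒∣∣≤ S T S⊆T

⊆-trans : ∀ {n} {R S T : Subset n} → R ⊆ S → S ⊆ T → R ⊆ T
⊆-trans R⊆S S⊆T = mk⊆ λ i → ⊆-lookup S⊆T i ∘ ⊆-lookup R⊆S i

∣∣≡count : ∀ {n} (S : Subset n) → ∣ S ∣ ≡ count (lookup S) (allFin n)
∣∣≡count []      = refl
∣∣≡count (x ∷ S) = trans (head x) (sym (count-allFin-suc (lookup (x ∷ S))))
  where
  head : ∀ x → ∣ x ∷ S ∣ ≡ (if x then 1 else 0) + count (lookup S) (allFin _)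
  head true  = cong suc (∣∣≡count S)
  head false = ∣∣≡count S

∣[]≔true∣ : ∀ {n} (S : Subset n) (a : Fin n) → lookup S a ≡ false → ∣ S [ a ]≔ true ∣ ≡ suc ∣ S ∣
∣[]≔true∣ (false ∷ S) zero    _    = refl
∣[]≔true∣ (true  ∷ S) (suc a) a∉S = cong suc (∣[]≔true∣ S a a∉S)
∣[]≔true∣ (false ∷ S) (suc a) a∉S = ∣[]≔true∣ S a a∉S

[]≔true-self : ∀ {n} (S : Subset n) a → lookup (S [ a ]≔ true) a ≡ true
[]≔true-self S a = lookup∘update a S true

[]≔true-⊇ : ∀ {n} (S : Subset n) a → S ⊆ (S [ a ]≔ true)
[]≔true-⊇ S a = mk⊆ member
  where
  member : ∀ i → lookup S i ≡ true → lookup (S [ a ]≔ true) i ≡ true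
  member i i∈S with i Fin.≟ a
  ... | yes refl = []≔true-self S a
  ... | no  i≢a  = trans (lookup∘update′ i≢a S true) i∈S

[]≔true-⊆ : ∀ {n} {S T : Subset n} {a} → lookup T a ≡ true → S ⊆ T → (S [ a ]≔ true) ⊆ T
[]≔true-⊆ {S = S} {T} {a} a∈T S⊆T = mk⊆ member
  where
  member : ∀ i → lookup (S [ a ]≔ true) i ≡ true → lookup T i ≡ true
  member i i∈ with i Fin.≟ a
  ... | yes refl = a∈T
  ... | no  i≢a  = ⊆-lookup S⊆T i (trans (sym (lookup∘update′ i≢a S true)) i∈)

∈⁅⁆⇒≡ : ∀ {n} {a b : Fin n} → lookup ⁅ b ⁆ a ≡ true → a ≡ b
∈⁅⁆⇒≡ {a = a} {b} a∈⁅b⁆ = x∈⁅y⁆⇒x≡y b (lookup⇒[]= a ⁅ b ⁆ a∈⁅b⁆)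

∈⁅⁆-self : ∀ {n} (b : Fin n) → lookup ⁅ b ⁆ b ≡ true
∈⁅⁆-self b = []=⇒lookup (x∈⁅x⁆ b)

∉⁅⁆ : ∀ {n} {a b : Fin n} → a ≢ b → lookup ⁅ b ⁆ a ≡ false
∉⁅⁆ {a = a} {b} a≢b with lookup ⁅ b ⁆ a in a∈⁅b⁆
... | false = refl
... | true  = ⊥-elim (a≢b (∈⁅⁆⇒≡ a∈⁅b⁆))

⁅⁆-⊆ : ∀ {n} {b : Fin n} {T} → lookup T b ≡ true → ⁅ b ⁆ ⊆ T
⁅⁆-⊆ {T = T} b∈T = mk⊆ λ i i∈⁅b⁆ → subst (λ j → lookup T j ≡ true) (sym (∈⁅⁆⇒≡ i∈⁅b⁆)) b∈T

pair : ∀ {n} → Fin n → Fin n → Subset n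
pair a b = ⁅ b ⁆ [ a ]≔ true

triple : ∀ {n} → Fin n → Fin n → Fin n → Subset n
triple a b x = pair b x [ a ]≔ true

∣pair∣ : ∀ {n} {a b : Fin n} → a ≢ b → ∣ pair a b ∣ ≡ 2
∣pair∣ {a = a} {b} a≢b = trans (∣[]≔true∣ ⁅ b ⁆ a (∉⁅⁆ a≢b)) (cong suc (∣⁅x⁆∣≡1 b))

∣triple∣ : ∀ {n} {a b x : Fin n} → a ≢ b → a ≢ x → b ≢ x → ∣ triple a b x ∣ ≡ 3
∣triple∣ {a = a} {b} {x} a≢b a≢x b≢x =
  trans (∣[]≔true∣ (pair b x) a (trans (lookup∘update′ a≢b ⁅ x ⁆ true) (∉⁅⁆ a≢x))) (cong suc (∣pair∣ b≢x))

pair-⊆ : ∀ {n} {a b : Fin n} {T} → lookup T a ≡ true → lookup T b ≡ true → pair a b ⊆ T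
pair-⊆ a∈T b∈T = []≔true-⊆ a∈T (⁅⁆-⊆ b∈T)

triple-⊆ : ∀ {n} {a b x : Fin n} {T} → lookup T a ≡ true → lookup T b ≡ true → lookup T x ≡ true → triple a b x ⊆ T
triple-⊆ a∈T b∈T x∈T = []≔true-⊆ a∈T (pair-⊆ b∈T x∈T)

pair⊆triple : ∀ {n} (a b x : Fin n) → pair a b ⊆ triple a b x
pair⊆triple a b x = pair-⊆ ([]≔true-self (pair b x) a) (⊆-lookup ([]≔true-⊇ (pair b x) a) b ([]≔true-self ⁅ x ⁆ b))

∈pairˡ : ∀ {n} (a b : Fin n) → lookup (pair a b) a ≡ true
∈pairˡ a b = []≔true-self ⁅ b ⁆ a

∈pairʳ : ∀ {n} (a b : Fin n) → lookup (pair a b) b ≡ true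
∈pairʳ a b = ⊆-lookup ([]≔true-⊇ ⁅ b ⁆ a) b (∈⁅⁆-self b)

∈tripleʳ : ∀ {n} (a b x : Fin n) → lookup (triple a b x) x ≡ true
∈tripleʳ a b x = ⊆-lookup ([]≔true-⊇ (pair b x) a) x (∈pairʳ b x)

pairsIn : ∀ {n} → Subset n → Fin n → ℕ
pairsIn {n} S u = count (λ v → ⌊ u Fin.<? v ⌋ ∧ (lookup S u ∧ lookup S v)) (allFin n)

pairCount : ∀ {n} → Subset n → ℕ
pairCount {n} S = foldr _+_ 0 (map (pairsIn S) (allFin n))

pairCount-∷ : ∀ {n} x (S : Subset n) → pairCount (x ∷ S) ≡ (if x then ∣ S ∣ else 0) + pairCount S
pairCount-∷ {n} x S = cong₂ _+_ (first x) (cong (foldr _+_ 0) (begin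
  map (pairsIn (x ∷ S)) (Data.List.tabulate suc) ≡⟨ map-tabulate suc (pairsIn (x ∷ S)) ⟩
  Data.List.tabulate (pairsIn (x ∷ S) ∘ suc)  ≡⟨ tabulate-cong later ⟩
  Data.List.tabulate (pairsIn S)              ≡⟨ map-tabulate id (pairsIn S) ⟨
  map (pairsIn S) (allFin n)                  ∎))
  where
  open ≡-Reasoning
  first : ∀ x → pairsIn (x ∷ S) zero ≡ (if x then ∣ S ∣ else 0)
  first true  = trans (count-allFin-suc {n} (λ v → ⌊ zero {n} Fin.<? v ⌋ ∧ (true ∧ lookup (true ∷ S) v)))
                      (sym (∣∣≡count S))
  first false = trans (count-allFin-suc {n} (λ v → ⌊ zero {n} Fin.<? v ⌋ ∧ (false ∧ lookup (false ∷ S) v)))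
                      (count-false (allFin n))
  later : ∀ u → pairsIn (x ∷ S) (suc u) ≡ pairsIn S u
  later u = trans (count-allFin-suc {n} (λ v → ⌊ suc u Fin.<? v ⌋ ∧ (lookup S u ∧ lookup (x ∷ S) v)))
                  (count-cong (allFin n) λ v → cong (_∧ (lookup S u ∧ lookup S v)) (⌊suc<?suc⌋ u v))

pairCount≡C2 : ∀ {n} (S : Subset n) → pairCount S ≡ ∣ S ∣ C 2
pairCount≡C2 []          = refl
pairCount≡C2 (true  ∷ S) = begin
  pairCount (true ∷ S)    ≡⟨ pairCount-∷ true S ⟩
  ∣ S ∣ + pairCount S     ≡⟨ cong₂ _+_ (sym (nC1≡n ∣ S ∣)) (pairCount≡C2 S) ⟩
  ∣ S ∣ C 1 + ∣ S ∣ C 2   ≡⟨ pascal ∣ S ∣ 1 ⟨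
  suc ∣ S ∣ C 2           ∎
  where open ≡-Reasoning
pairCount≡C2 (false ∷ S) = trans (pairCount-∷ false S) (pairCount≡C2 S)

-- Counting the subsets between two given ones

between : ∀ {n} → Subset n → Subset n → ℕ → Subset n → Bool
between B A k S = S ⊆ᵇ A ∧ (B ⊆ᵇ S ∧ ⌊ ∣ S ∣ ℕ.≟ k ⌋)

between-⊆ : ∀ {n} (B A : Subset n) k S → between B A k S ≡ true → S ⊆ A
between-⊆ B A k S e = ⊆ᵇ⇒⊆ S A (∧-elimˡ (S ⊆ᵇ A) e)

between-⊇ : ∀ {n} (B A : Subset n) k S → between B A k S ≡ true → B ⊆ S
between-⊇ B A k S e = ⊆ᵇ⇒⊆ B S (∧-elimˡ (B ⊆ᵇ S) (∧-elimʳ (S ⊆ᵇ A) e))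

between-intro : ∀ {n} {B A : Subset n} {k} S → S ⊆ A → B ⊆ S → ⌊ ∣ S ∣ ℕ.≟ k ⌋ ≡ true → between B A k S ≡ true
between-intro {B = B} {A} S S⊆A B⊆S size = ∧-intro (⊆⇒⊆ᵇ S A S⊆A) (∧-intro (⊆⇒⊆ᵇ B S B⊆S) size)

between-antimono : ∀ {n} {B′} (B A : Subset n) k S → B′ ⊆ B → between B A k S ≡ true → between B′ A k S ≡ true
between-antimono B A k S B′⊆B e =
  between-intro S (between-⊆ B A k S e) (⊆-trans B′⊆B (between-⊇ B A k S e)) (∧-elimʳ (B ⊆ᵇ S) (∧-elimʳ (S ⊆ᵇ A) e))

∈-allSubsets : ∀ {n} (S : Subset n) → S ∈ allSubsets n
∈-allSubsets []          = here refl
∈-allSubsets (false ∷ S) = ∈-++⁺ˡ (∈-map⁺ (false ∷_) (∈-allSubsets S))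
∈-allSubsets (true  ∷ S) = ∈-++⁺ʳ _ (∈-map⁺ (true ∷_) (∈-allSubsets S))

count-allSubsets-suc : ∀ {n} (p : Subset (suc n) → Bool) →
  count p (allSubsets (suc n)) ≡ count (p ∘ (false ∷_)) (allSubsets n) + count (p ∘ (true ∷_)) (allSubsets n)
count-allSubsets-suc {n} p = begin
  count p (map (false ∷_) (allSubsets n) ++ map (true ∷_) (allSubsets n))
    ≡⟨ count-++ p (map (false ∷_) (allSubsets n)) _ ⟩
  count p (map (false ∷_) (allSubsets n)) + count p (map (true ∷_) (allSubsets n))
    ≡⟨ cong₂ _+_ (count-map p _ (allSubsets n)) (count-map p _ (allSubsets n)) ⟩
  count (p ∘ (false ∷_)) (allSubsets n) + count (p ∘ (true ∷_)) (allSubsets n) ∎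
  where open ≡-Reasoning

-- A coordinate lying in A but not in B is either left out of S or taken: Pascal's rule.
count-between : ∀ {n} (B A : Subset n) (j : ℕ) → B ⊆ᵇ A ≡ true →
                count (between B A (j + ∣ B ∣)) (allSubsets n) ≡ (∣ A ∣ ∸ ∣ B ∣) C j
count-between []      []      zero    _ = refl
count-between []      []      (suc j) _ = refl
count-between {suc n} (false ∷ B) (false ∷ A) j B⊆A =
  trans (count-allSubsets-suc (between (false ∷ B) (false ∷ A) (j + ∣ B ∣)))
        (trans (cong₂ _+_ (count-between B A j B⊆A) (count-none _ (allSubsets n) (λ _ → refl)))
               (+-identityʳ _))
count-between {suc n} (true ∷ B) (true ∷ A) j B⊆A =
  trans (count-allSubsets-suc (between (true ∷ B) (true ∷ A) (j + suc ∣ B ∣)))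
        (cong₂ _+_ (count-none _ (allSubsets n) (λ S → ∧-zeroʳ (S ⊆ᵇ A)))
                   (trans (count-cong (allSubsets n) size) (count-between B A j B⊆A)))
  where
  size : ∀ S → between (true ∷ B) (true ∷ A) (j + suc ∣ B ∣) (true ∷ S) ≡ between B A (j + ∣ B ∣) S
  size S = cong (λ k → S ⊆ᵇ A ∧ (B ⊆ᵇ S ∧ k))
                (trans (cong (λ k → ⌊ suc ∣ S ∣ ℕ.≟ k ⌋) (+-suc j ∣ B ∣)) (⌊suc≟suc⌋ ∣ S ∣ (j + ∣ B ∣)))
count-between {suc n} (false ∷ B) (true ∷ A) zero B⊆A =
  trans (count-allSubsets-suc (between (false ∷ B) (true ∷ A) ∣ B ∣))
        (cong₂ _+_ (count-between B A zero B⊆A) (count-none _ (allSubsets n) too-big))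
  where
  too-big : ∀ S → between (false ∷ B) (true ∷ A) ∣ B ∣ (true ∷ S) ≡ false
  too-big S with B ⊆ᵇ S in B⊆S
  ... | false = ∧-zeroʳ (S ⊆ᵇ A)
  ... | true with suc ∣ S ∣ ℕ.≟ ∣ B ∣
  ...   | no  _ = ∧-zeroʳ (S ⊆ᵇ A)
  ...   | yes eq = ⊥-elim (<-irrefl (sym eq) (s≤s (⊆ᵇ⇒∣∣≤ B S B⊆S)))
count-between {suc n} (false ∷ B) (true ∷ A) (suc j) B⊆A = begin
  count (between (false ∷ B) (true ∷ A) (suc j + ∣ B ∣)) (allSubsets (suc n))
    ≡⟨ count-allSubsets-suc (between (false ∷ B) (true ∷ A) (suc j + ∣ B ∣)) ⟩
  count (between B A (suc j + ∣ B ∣)) (allSubsets n)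
    + count (between (false ∷ B) (true ∷ A) (suc j + ∣ B ∣) ∘ (true ∷_)) (allSubsets n)
    ≡⟨ cong₂ _+_ (count-between B A (suc j) B⊆A) (trans (count-cong (allSubsets n) size) (count-between B A j B⊆A)) ⟩
  (∣ A ∣ ∸ ∣ B ∣) C suc j + (∣ A ∣ ∸ ∣ B ∣) C j
    ≡⟨ trans (+-comm ((∣ A ∣ ∸ ∣ B ∣) C suc j) _) (sym (pascal (∣ A ∣ ∸ ∣ B ∣) j)) ⟩
  suc (∣ A ∣ ∸ ∣ B ∣) C suc j
    ≡⟨ cong (_C suc j) (sym (+-∸-assoc 1 (⊆ᵇ⇒∣∣≤ B A B⊆A))) ⟩
  (suc ∣ A ∣ ∸ ∣ B ∣) C suc j ∎
  where
  open ≡-Reasoning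
  size : ∀ S → between (false ∷ B) (true ∷ A) (suc j + ∣ B ∣) (true ∷ S) ≡ between B A (j + ∣ B ∣) S
  size S = cong (λ k → S ⊆ᵇ A ∧ (B ⊆ᵇ S ∧ k)) (⌊suc≟suc⌋ ∣ S ∣ (j + ∣ B ∣))

count-between-sized : ∀ {n} (B A : Subset n) k → B ⊆ A → ∣ B ∣ ≤ k →
                      count (between B A k) (allSubsets n) ≡ (∣ A ∣ ∸ ∣ B ∣) C (k ∸ ∣ B ∣)
count-between-sized {n} B A k B⊆A ∣B∣≤k =
  trans (cong (λ k′ → count (between B A k′) (allSubsets n)) (sym (m∸n+n≡m ∣B∣≤k)))
        (count-between B A (k ∸ ∣ B ∣) (⊆⇒⊆ᵇ B A B⊆A))

fromℕ : ℕ → ℚ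
fromℕ k = ℤ.+ k / 1

fromℕ-normal : ∀ k → fromℕ k ≡ mkℚ (ℤ.+ k) 0 (coprime-sym (1-coprimeTo k))
fromℕ-normal k = ℚ.normalize-coprime (coprime-sym (1-coprimeTo k))

recip-normal : ∀ k → recip (suc k) ≡ mkℚ (ℤ.+ 1) k (1-coprimeTo (suc k))
recip-normal k = ℚ.normalize-coprime (1-coprimeTo (suc k))

fromℕ-+ : ∀ a b → fromℕ (a + b) ≡ fromℕ a +ℚ fromℕ b
fromℕ-+ a b rewrite fromℕ-normal a | fromℕ-normal b =
  cong (_/ 1) (sym (cong₂ ℤ._+_ (ℤ.*-identityʳ (ℤ.+ a)) (ℤ.*-identityʳ (ℤ.+ b))))

fromℕ-mono-≤ : ∀ {a b} → a ≤ b → fromℕ a ≤ℚ fromℕ b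
fromℕ-mono-≤ {a} {b} a≤b rewrite fromℕ-normal a | fromℕ-normal b =
  *≤* (subst₂ ℤ._≤_ (sym (ℤ.*-identityʳ (ℤ.+ a))) (sym (ℤ.*-identityʳ (ℤ.+ b))) (ℤ.+≤+ a≤b))

fromℕ-injective : ∀ {a b} → fromℕ a ≡ fromℕ b → a ≡ b
fromℕ-injective {a} {b} eq rewrite fromℕ-normal a | fromℕ-normal b =
  ℤ.+-injective (cong ↥_ eq)

0ℚ≢1ℚ : 0ℚ ≢ 1ℚ
0ℚ≢1ℚ eq with fromℕ-injective {0} {1} eq
... | ()

fromℕ*recip≡1 : ∀ k → fromℕ (suc k) *ℚ recip (suc k) ≡ 1ℚ
fromℕ*recip≡1 k rewrite fromℕ-normal (suc k) | recip-normal k =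
  ℚ.*-inverseʳ (mkℚ (ℤ.+ suc k) 0 (coprime-sym (1-coprimeTo (suc k))))

recip-nonNeg : ∀ k → 0ℚ ≤ℚ recip k
recip-nonNeg zero    = ℚ.≤-refl
recip-nonNeg (suc k) rewrite recip-normal k = *≤* (ℤ.+≤+ z≤n)

recip-antimono : ∀ {m n} → 0 < m → m ≤ n → recip n ≤ℚ recip m
recip-antimono {suc c} {suc d} _ c<d rewrite recip-normal c | recip-normal d =
  *≤* (subst₂ ℤ._≤_ (sym (ℤ.*-identityˡ (ℤ.+ suc c))) (sym (ℤ.*-identityˡ (ℤ.+ suc d))) (ℤ.+≤+ c<d))

*recip-monoˡ : ∀ k {p q} → p ≤ℚ q → p *ℚ recip (suc k) ≤ℚ q *ℚ recip (suc k)
*recip-monoˡ k = ℚ.*-monoʳ-≤-nonNeg (recip (suc k)) {{nonNegative (recip-nonNeg (suc k))}}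

*-fromℕ*recip : ∀ k p → fromℕ (suc k) *ℚ p *ℚ recip (suc k) ≡ p
*-fromℕ*recip k p = begin
  fromℕ (suc k) *ℚ p *ℚ recip (suc k)     ≡⟨ cong (_*ℚ recip (suc k)) (ℚ.*-comm (fromℕ (suc k)) p) ⟩
  p *ℚ fromℕ (suc k) *ℚ recip (suc k)     ≡⟨ ℚ.*-assoc p _ _ ⟩
  p *ℚ (fromℕ (suc k) *ℚ recip (suc k))   ≡⟨ cong (p *ℚ_) (fromℕ*recip≡1 k) ⟩
  p *ℚ 1ℚ                                 ≡⟨ ℚ.*-identityʳ p ⟩
  p                                       ∎
  where open ≡-Reasoning

fromℕ*recip≡1⇒≡ : ∀ a k → fromℕ a *ℚ recip (suc k) ≡ 1ℚ → a ≡ suc k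
fromℕ*recip≡1⇒≡ a k eq = fromℕ-injective (begin
  fromℕ a                                       ≡⟨ *-fromℕ*recip k (fromℕ a) ⟨
  fromℕ (suc k) *ℚ fromℕ a *ℚ recip (suc k)     ≡⟨ ℚ.*-assoc (fromℕ (suc k)) _ _ ⟩
  fromℕ (suc k) *ℚ (fromℕ a *ℚ recip (suc k))   ≡⟨ cong (fromℕ (suc k) *ℚ_) eq ⟩
  fromℕ (suc k) *ℚ 1ℚ                           ≡⟨ ℚ.*-identityʳ _ ⟩
  fromℕ (suc k)                                 ∎)
  where open ≡-Reasoning

≤-*recip : ∀ {k} → 0 < k → ∀ {p q} → fromℕ k *ℚ p ≤ℚ q → p ≤ℚ q *ℚ recip k
≤-*recip {suc k} _ {p} {q} kp≤q = subst (_≤ℚ q *ℚ recip (suc k)) (*-fromℕ*recip k p) (*recip-monoˡ k kp≤q)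

*≡⇔≡*recip : ∀ {k} → 0 < k → ∀ {p q} → (fromℕ k *ℚ p ≡ q) ⇔ (p ≡ q *ℚ recip k)
*≡⇔≡*recip {suc k} _ {p} {q} = mk⇔
  (λ kp≡q → trans (sym (*-fromℕ*recip k p)) (cong (_*ℚ recip (suc k)) kp≡q))
  (λ p≡q/k → trans (cong (fromℕ (suc k) *ℚ_) p≡q/k) (begin
    fromℕ (suc k) *ℚ (q *ℚ recip (suc k)) ≡⟨ cong (fromℕ (suc k) *ℚ_) (ℚ.*-comm q _) ⟩
    fromℕ (suc k) *ℚ (recip (suc k) *ℚ q) ≡⟨ ℚ.*-assoc (fromℕ (suc k)) _ q ⟨
    fromℕ (suc k) *ℚ recip (suc k) *ℚ q   ≡⟨ cong (_*ℚ q) (fromℕ*recip≡1 k) ⟩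
    1ℚ *ℚ q                              ≡⟨ ℚ.*-identityˡ q ⟩
    q                                   ∎))
  where open ≡-Reasoning

+-mono-≤-equality : ∀ {p q p′ q′} → p ≤ℚ q → p′ ≤ℚ q′ → p +ℚ p′ ≡ q +ℚ q′ → p ≡ q × p′ ≡ q′
+-mono-≤-equality p≤q p′≤q′ eq =
  ℚ.≤-antisym p≤q (ℚ.≮⇒≥ λ p>q → ℚ.<-irrefl eq (ℚ.+-mono-<-≤ p>q p′≤q′)) ,
  ℚ.≤-antisym p′≤q′ (ℚ.≮⇒≥ λ p′>q′ → ℚ.<-irrefl eq (ℚ.+-mono-≤-< p≤q p′>q′))

∑ : List A → (A → ℚ) → ℚ
∑ xs f = sumℚ (map f xs)

syntax ∑ xs (λ x → f) = ∑[ x ∈ xs ] f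

∑-cong : (xs : List A) {f g : A → ℚ} → (∀ x → f x ≡ g x) → ∑ xs f ≡ ∑ xs g
∑-cong []       f≗g = refl
∑-cong (x ∷ xs) f≗g = cong₂ _+ℚ_ (f≗g x) (∑-cong xs f≗g)

∑-cong-∈ : (xs : List A) {f g : A → ℚ} → (∀ x → x ∈ xs → f x ≡ g x) → ∑ xs f ≡ ∑ xs g
∑-cong-∈ []       f≗g = refl
∑-cong-∈ (x ∷ xs) f≗g = cong₂ _+ℚ_ (f≗g x (here refl)) (∑-cong-∈ xs (λ y y∈xs → f≗g y (there y∈xs)))

∑-zero : (xs : List A) → ∑[ x ∈ xs ] 0ℚ ≡ 0ℚ
∑-zero []       = refl
∑-zero (x ∷ xs) = trans (ℚ.+-identityˡ _) (∑-zero xs)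

∑-+ : (xs : List A) (f g : A → ℚ) → ∑[ x ∈ xs ] (f x +ℚ g x) ≡ ∑ xs f +ℚ ∑ xs g
∑-+ []       f g = refl
∑-+ (x ∷ xs) f g = trans (cong (f x +ℚ g x +ℚ_) (∑-+ xs f g)) (interchange (f x) (g x) _ _)

*-distribˡ-∑ : (c : ℚ) (xs : List A) (f : A → ℚ) → c *ℚ ∑ xs f ≡ ∑[ x ∈ xs ] (c *ℚ f x)
*-distribˡ-∑ c []       f = ℚ.*-zeroʳ c
*-distribˡ-∑ c (x ∷ xs) f = trans (ℚ.*-distribˡ-+ c (f x) (∑ xs f)) (cong (c *ℚ f x +ℚ_) (*-distribˡ-∑ c xs f))

∑-*ʳ : (xs : List A) (f : A → ℚ) (c : ℚ) → ∑[ x ∈ xs ] (f x *ℚ c) ≡ ∑ xs f *ℚ c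
∑-*ʳ []       f c = sym (ℚ.*-zeroˡ c)
∑-*ʳ (x ∷ xs) f c = trans (cong (f x *ℚ c +ℚ_) (∑-*ʳ xs f c)) (sym (ℚ.*-distribʳ-+ c (f x) (∑ xs f)))

∑-comm : (xs : List A) (ys : List B) (g : A → B → ℚ) →
         ∑[ x ∈ xs ] ∑[ y ∈ ys ] g x y ≡ ∑[ y ∈ ys ] ∑[ x ∈ xs ] g x y
∑-comm []       ys g = sym (∑-zero ys)
∑-comm (x ∷ xs) ys g = trans (cong (∑ ys (g x) +ℚ_) (∑-comm xs ys g)) (sym (∑-+ ys (g x) _))

∑-mono-≤ : (xs : List A) {f g : A → ℚ} → (∀ x → f x ≤ℚ g x) → ∑ xs f ≤ℚ ∑ xs g
∑-mono-≤ []       f≤g = ℚ.≤-refl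
∑-mono-≤ (x ∷ xs) f≤g = ℚ.+-mono-≤ (f≤g x) (∑-mono-≤ xs f≤g)

∑-mono-≤-equality : (xs : List A) {f g : A → ℚ} → (∀ x → f x ≤ℚ g x) →
                    ∑ xs f ≡ ∑ xs g → ∀ x → x ∈ xs → f x ≡ g x
∑-mono-≤-equality (y ∷ xs) f≤g eq x (here refl) =
  Data.Product.proj₁ (+-mono-≤-equality (f≤g y) (∑-mono-≤ xs f≤g) eq)
∑-mono-≤-equality (y ∷ xs) f≤g eq x (there x∈xs) =
  ∑-mono-≤-equality xs f≤g (Data.Product.proj₂ (+-mono-≤-equality (f≤g y) (∑-mono-≤ xs f≤g) eq)) x x∈xs

∑-if-false : (xs : List A) (p : A → Bool) (f : A → ℚ) → (∀ x → x ∈ xs → p x ≡ false) →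
             ∑[ x ∈ xs ] (if p x then f x else 0ℚ) ≡ 0ℚ
∑-if-false xs p f none = trans (∑-cong-∈ xs (λ x x∈xs → cong (if_then f x else 0ℚ) (none x x∈xs))) (∑-zero xs)

∑-pull-if : (xs : List A) (b : Bool) (f : A → ℚ) →
            ∑[ x ∈ xs ] (if b then f x else 0ℚ) ≡ (if b then ∑ xs f else 0ℚ)
∑-pull-if xs true  f = refl
∑-pull-if xs false f = ∑-zero xs

∑-filter : {P : A → Set} (P? : Decidable P) (xs : List A) (f : A → ℚ) →
           ∑ (filter P? xs) f ≡ ∑[ x ∈ xs ] (if does (P? x) then f x else 0ℚ)
∑-filter P? []       f = refl
∑-filter P? (x ∷ xs) f with does (P? x)
... | true  = cong (f x +ℚ_) (∑-filter P? xs f)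
... | false = trans (∑-filter P? xs f) (sym (ℚ.+-identityˡ _))

fromℕ-suc-* : ∀ k p → fromℕ (suc k) *ℚ p ≡ p +ℚ fromℕ k *ℚ p
fromℕ-suc-* k p = begin
  fromℕ (suc k) *ℚ p        ≡⟨ cong (_*ℚ p) (fromℕ-+ 1 k) ⟩
  (1ℚ +ℚ fromℕ k) *ℚ p      ≡⟨ ℚ.*-distribʳ-+ p 1ℚ (fromℕ k) ⟩
  1ℚ *ℚ p +ℚ fromℕ k *ℚ p   ≡⟨ cong (_+ℚ fromℕ k *ℚ p) (ℚ.*-identityˡ p) ⟩
  p +ℚ fromℕ k *ℚ p         ∎
  where open ≡-Reasoning

∑-indicator : (xs : List A) (p : A → Bool) (c : ℚ) →
              ∑[ x ∈ xs ] (if p x then c else 0ℚ) ≡ fromℕ (count p xs) *ℚ c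
∑-indicator []       p c = sym (ℚ.*-zeroˡ c)
∑-indicator (x ∷ xs) p c with p x
... | true  = trans (cong (c +ℚ_) (∑-indicator xs p c)) (sym (fromℕ-suc-* (count p xs) c))
... | false = trans (ℚ.+-identityˡ _) (∑-indicator xs p c)

∑-if-≤ : (xs : List A) (p : A → Bool) (f : A → ℚ) (c : ℚ) → (∀ x → p x ≡ true → f x ≤ℚ c) →
         ∑[ x ∈ xs ] (if p x then f x else 0ℚ) ≤ℚ fromℕ (count p xs) *ℚ c
∑-if-≤ xs p f c f≤c = subst (_ ≤ℚ_) (∑-indicator xs p c) (∑-mono-≤ xs bound)
  where
  bound : ∀ x → (if p x then f x else 0ℚ) ≤ℚ (if p x then c else 0ℚ)
  bound x with p x in px
  ... | true  = f≤c x px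
  ... | false = ℚ.≤-refl

fromℕ-∑ : (xs : List A) (h : A → ℕ) → fromℕ (foldr _+_ 0 (map h xs)) ≡ ∑[ x ∈ xs ] fromℕ (h x)
fromℕ-∑ []       h = refl
fromℕ-∑ (x ∷ xs) h = trans (fromℕ-+ (h x) _) (cong (fromℕ (h x) +ℚ_) (fromℕ-∑ xs h))

module _ (xs : List A) (p : A → Bool) (w : A → ℕ) where

  ∑-if-recip-none : count p xs ≡ 0 → ∑[ x ∈ xs ] (if p x then recip (w x) else 0ℚ) ≡ 0ℚ
  ∑-if-recip-none none = ∑-if-false xs p (recip ∘ w) (count-zero p xs none)

  ∑-if-recip-≤1 : ∀ k → count p xs ≤ k → (∀ x → p x ≡ true → k ≤ w x) →
                  ∑[ x ∈ xs ] (if p x then recip (w x) else 0ℚ) ≤ℚ 1ℚ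
  ∑-if-recip-≤1 zero    count≤0 _   =
    ℚ.≤-trans (ℚ.≤-reflexive (∑-if-recip-none (n≤0⇒n≡0 count≤0))) (fromℕ-mono-≤ {0} {1} z≤n)
  ∑-if-recip-≤1 (suc k) count≤k k≤w = begin
    ∑[ x ∈ xs ] (if p x then recip (w x) else 0ℚ)
      ≤⟨ ∑-if-≤ xs p (recip ∘ w) _ (λ x px → recip-antimono (s≤s z≤n) (k≤w x px)) ⟩
    fromℕ (count p xs) *ℚ recip (suc k)
      ≤⟨ *recip-monoˡ k (fromℕ-mono-≤ count≤k) ⟩
    fromℕ (suc k) *ℚ recip (suc k)
      ≡⟨ fromℕ*recip≡1 k ⟩
    1ℚ ∎
    where open ℚ.≤-Reasoning

  ∑-if-recip-≡1⇒ : ∀ k → count p xs ≤ k → (∀ x → p x ≡ true → k ≤ w x) →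
                   ∑[ x ∈ xs ] (if p x then recip (w x) else 0ℚ) ≡ 1ℚ → 0 < k × count p xs ≡ k
  ∑-if-recip-≡1⇒ zero count≤0 _ sum≡1 =
    ⊥-elim (0ℚ≢1ℚ (trans (sym (∑-if-recip-none (n≤0⇒n≡0 count≤0))) sum≡1))
  ∑-if-recip-≡1⇒ (suc k) count≤k k≤w sum≡1 = s≤s z≤n , fromℕ*recip≡1⇒≡ (count p xs) k (ℚ.≤-antisym upper lower)
    where
    upper : fromℕ (count p xs) *ℚ recip (suc k) ≤ℚ 1ℚ
    upper = ℚ.≤-trans (*recip-monoˡ k (fromℕ-mono-≤ count≤k)) (ℚ.≤-reflexive (fromℕ*recip≡1 k))
    lower : 1ℚ ≤ℚ fromℕ (count p xs) *ℚ recip (suc k)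
    lower = subst (_≤ℚ _) sum≡1 (∑-if-≤ xs p (recip ∘ w) _ (λ x px → recip-antimono (s≤s z≤n) (k≤w x px)))

  ∑-if-recip-≡1 : ∀ k → 0 < k → count p xs ≡ k → (∀ x → p x ≡ true → w x ≡ k) →
                  ∑[ x ∈ xs ] (if p x then recip (w x) else 0ℚ) ≡ 1ℚ
  ∑-if-recip-≡1 (suc k) _ count≡k w≡k = begin
    ∑[ x ∈ xs ] (if p x then recip (w x) else 0ℚ)     ≡⟨ ∑-cong xs constant ⟩
    ∑[ x ∈ xs ] (if p x then recip (suc k) else 0ℚ)   ≡⟨ ∑-indicator xs p (recip (suc k)) ⟩
    fromℕ (count p xs) *ℚ recip (suc k)                ≡⟨ cong (λ c → fromℕ c *ℚ recip (suc k)) count≡k ⟩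
    fromℕ (suc k) *ℚ recip (suc k)                     ≡⟨ fromℕ*recip≡1 k ⟩
    1ℚ                                                ∎
    where
    open ≡-Reasoning
    constant : ∀ x → (if p x then recip (w x) else 0ℚ) ≡ (if p x then recip (suc k) else 0ℚ)
    constant x with p x in px
    ... | true  = cong recip (w≡k x px)
    ... | false = refl

allV-sound : ∀ {n} (p : Fin n → Bool) → allV p ≡ true → ∀ u → p u ≡ true
allV-sound p all u = all-sound p (allFin _) all u (∈-allFin u)

allV-complete : ∀ {n} (p : Fin n → Bool) → (∀ u → p u ≡ true) → allV p ≡ true
allV-complete p = all-complete p (allFin _)

module _ {n} (G : Graph n) where

  isClique⇒adj : ∀ S {u v} → isCliqueSet G S ≡ true →
                 lookup S u ≡ true → lookup S v ≡ true → u ≢ v → adj G u v ≡ true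
  isClique⇒adj S {u} {v} clique u∈S v∈S u≢v =
    subst (λ b → (if b then adj G u v else true) ≡ true) in-S
          (allV-sound _ (allV-sound _ clique u) v)
    where
    in-S : lookup S u ∧ lookup S v ∧ not ⌊ u Fin.≟ v ⌋ ≡ true
    in-S rewrite u∈S | v∈S | ⌊⌋-false (u Fin.≟ v) u≢v = refl

  isClique-intro : ∀ S → (∀ u v → lookup S u ≡ true → lookup S v ≡ true → u ≢ v → adj G u v ≡ true) →
                   isCliqueSet G S ≡ true
  isClique-intro S adjacent = allV-complete _ λ u → allV-complete _ λ v → entry u v
    where
    entry : ∀ u v → (if lookup S u ∧ lookup S v ∧ not ⌊ u Fin.≟ v ⌋ then adj G u v else true) ≡ true
    entry u v with lookup S u in u∈S | lookup S v in v∈S | u Fin.≟ v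
    ... | true  | true  | no u≢v = adjacent u v u∈S v∈S u≢v
    ... | true  | true  | yes _  = refl
    ... | true  | false | _      = refl
    ... | false | _     | _      = refl

  deg≤theta : ∀ T {v} → lookup T v ≡ true → deg G v ≤ theta G T
  deg≤theta T {v} v∈T = subst (_≤ theta G T) (cong (if_then deg G v else 0) v∈T)
    (≤-foldr-⊔ (λ u → if lookup T u then deg G u else 0) (allFin n) v (∈-allFin v))

  theta≤ : ∀ T {d} → (∀ v → lookup T v ≡ true → deg G v ≤ d) → theta G T ≤ d
  theta≤ T {d} bound = foldr-⊔-≤ _ (allFin n) member
    where
    member : ∀ v → (if lookup T v then deg G v else 0) ≤ d
    member v with lookup T v in v∈T
    ... | true  = bound v v∈T
    ... | false = z≤n

  adj-sym : ∀ {u v} → adj G u v ≡ true → adj G v u ≡ true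
  adj-sym {u} {v} u~v = trans (Graph.sym G v u) u~v

  adj⇒≢ : ∀ {u v} → adj G u v ≡ true → u ≢ v
  adj⇒≢ {u} u~v refl with () ← trans (sym u~v) (irrefl G u)

  N[_] : Fin n → Subset n
  N[ a ] = tabulate (adj G a) [ a ]≔ true

  ∈N[]-self : ∀ a → lookup N[ a ] a ≡ true
  ∈N[]-self a = []≔true-self (tabulate (adj G a)) a

  adj⇒∈N[] : ∀ {a i} → adj G a i ≡ true → lookup N[ a ] i ≡ true
  adj⇒∈N[] {a} {i} a~i = ⊆-lookup ([]≔true-⊇ (tabulate (adj G a)) a) i (trans (lookup∘tabulate (adj G a) i) a~i)

  ∈N[]⇒adj : ∀ {a i} → lookup N[ a ] i ≡ true → i ≢ a → adj G a i ≡ true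
  ∈N[]⇒adj {a} {i} i∈N[a] i≢a =
    trans (sym (lookup∘tabulate (adj G a) i)) (trans (sym (lookup∘update′ i≢a (tabulate (adj G a)) true)) i∈N[a])

  ∣N[]∣ : ∀ a → ∣ N[ a ] ∣ ≡ suc (deg G a)
  ∣N[]∣ a = trans (∣[]≔true∣ (tabulate (adj G a)) a (trans (lookup∘tabulate (adj G a) a) (irrefl G a)))
                  (cong suc (trans (∣∣≡count (tabulate (adj G a))) (count-cong (allFin n) (lookup∘tabulate (adj G a)))))

  clique⊆N[] : ∀ T {a} → isCliqueSet G T ≡ true → lookup T a ≡ true → T ⊆ N[ a ]
  clique⊆N[] T {a} clique a∈T = mk⊆ member
    where
    member : ∀ i → lookup T i ≡ true → lookup N[ a ] i ≡ true
    member i i∈T with i Fin.≟ a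
    ... | yes refl = ∈N[]-self a
    ... | no  i≢a  = adj⇒∈N[] (isClique⇒adj T clique a∈T i∈T (i≢a ∘ sym))

  pair⊆N[] : ∀ {a b} → adj G a b ≡ true → pair a b ⊆ N[ a ]
  pair⊆N[] {a} a~b = pair-⊆ (∈N[]-self a) (adj⇒∈N[] a~b)

  2≤∣N[]∣ : ∀ {a b} → adj G a b ≡ true → 2 ≤ suc (deg G a)
  2≤∣N[]∣ {a} {b} a~b = subst₂ _≤_ (∣pair∣ (adj⇒≢ a~b)) (∣N[]∣ a)
                                   (⊆ᵇ⇒∣∣≤ (pair a b) N[ a ] (⊆⇒⊆ᵇ (pair a b) N[ a ] (pair⊆N[] a~b)))

  module _ (c : Fin n → Fin n) (c-adj : ∀ u v → (adj G u v ≡ true) ⇔ ((u ≢ v) × (c u ≡ c v))) where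
    open Equivalence

    adj≡same-label : ∀ v u → adj G v u ≡ ⌊ c u Fin.≟ c v ⌋ ∧ not ⌊ u Fin.≟ v ⌋
    adj≡same-label v u with u Fin.≟ v
    ... | yes refl = trans (irrefl G v) (sym (∧-zeroʳ _))
    ... | no  u≢v  = trans (≡-by-⇔ labels-agree adjacent) (sym (∧-identityʳ _))
      where
      labels-agree : adj G v u ≡ true → ⌊ c u Fin.≟ c v ⌋ ≡ true
      labels-agree v~u = ⌊⌋-true (c u Fin.≟ c v) (sym (proj₂ (to (c-adj v u) v~u)))
      adjacent : ⌊ c u Fin.≟ c v ⌋ ≡ true → adj G v u ≡ true
      adjacent same = from (c-adj v u) ((u≢v ∘ sym) , sym (⌊⌋-true⁻ (c u Fin.≟ c v) same))

    componentSize≡suc-deg : ∀ v → componentSize c v ≡ suc (deg G v)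
    componentSize≡suc-deg v = begin
      componentSize c v
        ≡⟨ count-allFin-remove (λ u → ⌊ c u Fin.≟ c v ⌋) v ⟩
      (if ⌊ c v Fin.≟ c v ⌋ then 1 else 0) + count (λ u → ⌊ c u Fin.≟ c v ⌋ ∧ not ⌊ u Fin.≟ v ⌋) (allFin n)
        ≡⟨ cong₂ _+_ (cong (if_then 1 else 0) (⌊⌋-true (c v Fin.≟ c v) refl))
                     (count-cong (allFin n) (sym ∘ adj≡same-label v)) ⟩
      suc (deg G v) ∎
      where open ≡-Reasoning

    same-label⇒same-deg : ∀ {u v} → c u ≡ c v → deg G u ≡ deg G v
    same-label⇒same-deg {u} {v} cu≡cv = suc-injective (begin
      suc (deg G u)     ≡⟨ componentSize≡suc-deg u ⟨
      componentSize c u ≡⟨ cong (λ z → count (λ w → ⌊ c w Fin.≟ z ⌋) (allFin n)) cu≡cv ⟩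
      componentSize c v ≡⟨ componentSize≡suc-deg v ⟩
      suc (deg G v)     ∎)
      where open ≡-Reasoning

    ∈N[]⇒same-label : ∀ {a i} → lookup N[ a ] i ≡ true → c i ≡ c a
    ∈N[]⇒same-label {a} {i} i∈N[a] with i Fin.≟ a
    ... | yes refl = refl
    ... | no  i≢a  = sym (proj₂ (to (c-adj a i) (∈N[]⇒adj i∈N[a] i≢a)))

    component-sizes : ∀ {t} → (∀ {a b} → adj G a b ≡ true → t ≤ suc (deg G a)) →
                      ∀ v → componentSize c v ≡ 1 ⊎ t ≤ componentSize c v
    component-sizes {t} bound v with deg G v in deg≡
    ... | zero  = inj₁ (trans (componentSize≡suc-deg v) (cong suc deg≡))
    ... | suc _ with count-pos (adj G v) (allFin n) (subst (0 <_) (sym deg≡) (s≤s z≤n))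
    ...   | b , _ , v~b = inj₂ (subst (t ≤_) (sym (componentSize≡suc-deg v)) (bound v~b))

  -- Closed neighbourhoods that agree along edges are the classes of an equivalence relation; each class is
  -- labelled by its first vertex.
  module _ (closed : ∀ {a b x} → adj G a b ≡ true → adj G a x ≡ true → x ≢ b → adj G b x ≡ true) where

    N[]-step : ∀ {a b} → adj G a b ≡ true → ∀ i → lookup N[ a ] i ≡ true → lookup N[ b ] i ≡ true
    N[]-step {a} {b} a~b i i∈N[a] with i Fin.≟ b | i Fin.≟ a
    ... | yes refl | _        = ∈N[]-self b
    ... | no  _    | yes refl = adj⇒∈N[] (adj-sym a~b)
    ... | no  i≢b  | no  i≢a  = adj⇒∈N[] (closed a~b (∈N[]⇒adj i∈N[a] i≢a) i≢b)

    adj⇒N[]≗ : ∀ {a b} → adj G a b ≡ true → ∀ i → lookup N[ a ] i ≡ lookup N[ b ] i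
    adj⇒N[]≗ a~b i = ≡-by-⇔ (N[]-step a~b i) (N[]-step (adj-sym a~b) i)

    ∈N[]⇒N[]≗ : ∀ {a x} → lookup N[ a ] x ≡ true → ∀ i → lookup N[ a ] i ≡ lookup N[ x ] i
    ∈N[]⇒N[]≗ {a} {x} x∈N[a] with x Fin.≟ a
    ... | yes refl = λ _ → refl
    ... | no  x≢a  = adj⇒N[]≗ (∈N[]⇒adj x∈N[a] x≢a)

    leader : Fin n → Fin n
    leader u = fromMaybe u (findᵇ (lookup N[ u ]) (allFin n))

    find-leader : ∀ u → findᵇ (lookup N[ u ]) (allFin n) ≡ just (leader u)
    -- Abstracting the search together with a witness that it succeeds leaves only the just case.
    find-leader u with findᵇ (lookup N[ u ]) (allFin n) | findᵇ-∈ (lookup N[ u ]) (∈-allFin u) (∈N[]-self u)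
    ... | just _ | _ = refl

    leader∈N[] : ∀ u → lookup N[ u ] (leader u) ≡ true
    leader∈N[] u = findᵇ-just (lookup N[ u ]) (allFin n) (find-leader u)

    leader-cong : ∀ {u v} → (∀ i → lookup N[ u ] i ≡ lookup N[ v ] i) → leader u ≡ leader v
    leader-cong {u} {v} N[u]≗N[v] =
      just-injective (trans (sym (find-leader u)) (trans (findᵇ-cong (allFin n) N[u]≗N[v]) (find-leader v)))

    adj⇔same-leader : ∀ u v → (adj G u v ≡ true) ⇔ ((u ≢ v) × (leader u ≡ leader v))
    adj⇔same-leader u v = mk⇔ (λ u~v → adj⇒≢ u~v , leader-cong (adj⇒N[]≗ u~v)) adjacent
      where
      adjacent : (u ≢ v) × (leader u ≡ leader v) → adj G u v ≡ true
      adjacent (u≢v , same) = ∈N[]⇒adj v∈N[u] (u≢v ∘ sym)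
        where
        leader∈N[v] : lookup N[ v ] (leader u) ≡ true
        leader∈N[v] = subst (λ z → lookup N[ v ] z ≡ true) (sym same) (leader∈N[] v)
        v∈N[u] : lookup N[ u ] v ≡ true
        v∈N[u] = trans (∈N[]⇒N[]≗ (leader∈N[] u) v) (trans (sym (∈N[]⇒N[]≗ leader∈N[v] v)) (∈N[]-self v))

-- The load of an edge

module _ {n} (G : Graph n) (t : ℕ) where

  isKt : Subset n → Bool
  isKt T = isCliqueSet G T ∧ ⌊ ∣ T ∣ ℕ.≟ t ⌋

  denominator : Subset n → ℕ
  denominator T = (theta G T ∸ 1) C (t ∸ 2)

  onEdge : Fin n → Fin n → Subset n → Bool
  onEdge a b T = isKt T ∧ (lookup T a ∧ lookup T b)

  load : Fin n → Fin n → ℚ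
  load a b = ∑[ T ∈ allSubsets n ] (if onEdge a b T then recip (denominator T) else 0ℚ)

  -- The number of (t-2)-subsets of N(a) ∖ {b}, i.e. of candidates for a t-clique through the edge ab.
  cliqueBound : Fin n → ℕ
  cliqueBound a = (deg G a ∸ 1) C (t ∸ 2)

  onEdge⇒ : ∀ a b T → onEdge a b T ≡ true →
            isCliqueSet G T ≡ true × ⌊ ∣ T ∣ ℕ.≟ t ⌋ ≡ true × lookup T a ≡ true × lookup T b ≡ true
  onEdge⇒ a b T on =
    ∧-elimˡ (isCliqueSet G T) Kt , ∧-elimʳ (isCliqueSet G T) Kt ,
    ∧-elimˡ (lookup T a) (∧-elimʳ (isKt T) on) , ∧-elimʳ (lookup T a) (∧-elimʳ (isKt T) on)
    where
    Kt : isKt T ≡ true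
    Kt = ∧-elimˡ (isKt T) on

  module _ {a b : Fin n} (a~b : adj G a b ≡ true) where

    onEdge⇒between : ∀ T → onEdge a b T ≡ true → between (pair a b) (N[_] G a) t T ≡ true
    onEdge⇒between T on with onEdge⇒ a b T on
    ... | clique , size , a∈T , b∈T = between-intro T (clique⊆N[] G T clique a∈T) (pair-⊆ a∈T b∈T) size

    count-between-edge : 2 ≤ t → count (between (pair a b) (N[_] G a) t) (allSubsets n) ≡ cliqueBound a
    count-between-edge t≥2 = begin
      count (between (pair a b) (N[_] G a) t) (allSubsets n)
        ≡⟨ count-between-sized (pair a b) (N[_] G a) t (pair⊆N[] G a~b) (subst (_≤ t) (sym ∣pair∣≡2) t≥2) ⟩
      (∣ N[_] G a ∣ ∸ ∣ pair a b ∣) C (t ∸ ∣ pair a b ∣)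
        ≡⟨ cong₂ (λ m k → (m ∸ k) C (t ∸ k)) (∣N[]∣ G a) ∣pair∣≡2 ⟩
      cliqueBound a ∎
      where
      open ≡-Reasoning
      ∣pair∣≡2 : ∣ pair a b ∣ ≡ 2
      ∣pair∣≡2 = ∣pair∣ (adj⇒≢ G a~b)

    count-onEdge≤cliqueBound : 2 ≤ t → count (onEdge a b) (allSubsets n) ≤ cliqueBound a
    count-onEdge≤cliqueBound t≥2 =
      subst (count (onEdge a b) (allSubsets n) ≤_) (count-between-edge t≥2) (count-mono onEdge⇒between (allSubsets n))

    cliqueBound≤denominator : ∀ T → onEdge a b T ≡ true → cliqueBound a ≤ denominator T
    cliqueBound≤denominator T on with onEdge⇒ a b T on
    ... | _ , _ , a∈T , _ = C-monoˡ-≤ (t ∸ 2) (∸-monoˡ-≤ 1 (deg≤theta G T a∈T))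

    load≤1 : 2 ≤ t → load a b ≤ℚ 1ℚ
    load≤1 t≥2 = ∑-if-recip-≤1 (allSubsets n) (onEdge a b) denominator (cliqueBound a)
                   (count-onEdge≤cliqueBound t≥2) cliqueBound≤denominator

  module _ {a b : Fin n} (t≥2 : 2 ≤ t) (a~b : adj G a b ≡ true) (load≡1 : load a b ≡ 1ℚ) where

    private
      saturated : 0 < cliqueBound a × count (onEdge a b) (allSubsets n) ≡ cliqueBound a
      saturated = ∑-if-recip-≡1⇒ (allSubsets n) (onEdge a b) denominator (cliqueBound a)
                    (count-onEdge≤cliqueBound a~b t≥2) (cliqueBound≤denominator a~b) load≡1

      between⇒onEdge : ∀ T → between (pair a b) (N[_] G a) t T ≡ true → onEdge a b T ≡ true
      between⇒onEdge T =
        count-mono-equality (onEdge⇒between a~b) (allSubsets n)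
          (trans (proj₂ saturated) (sym (count-between-edge a~b t≥2))) T (∈-allSubsets T)

    load≡1⇒t≤suc-deg : t ≤ suc (deg G a)
    load≡1⇒t≤suc-deg = begin
      t                  ≡⟨ m∸n+n≡m t≥2 ⟨
      t ∸ 2 + 2          ≤⟨ +-monoˡ-≤ 2 (C-pos⁻ (proj₁ saturated)) ⟩
      deg G a ∸ 1 + 2    ≡⟨ m∸n+n≡m (2≤∣N[]∣ G a~b) ⟩
      suc (deg G a)      ∎
      where open ≤-Reasoning

    private
      extend-triple : 3 ≤ t → ∀ {x} → adj G a x ≡ true → x ≢ b →
                      Σ (Subset n) λ T → between (triple a b x) (N[_] G a) t T ≡ true
      extend-triple t≥3 {x} a~x x≢b
        with count-pos (between (triple a b x) (N[_] G a) t) (allSubsets n) nonempty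
        where
        ∣triple∣≡3 : ∣ triple a b x ∣ ≡ 3
        ∣triple∣≡3 = ∣triple∣ (adj⇒≢ G a~b) (adj⇒≢ G a~x) (x≢b ∘ sym)
        nonempty : 0 < count (between (triple a b x) (N[_] G a) t) (allSubsets n)
        nonempty = subst (0 <_)
          (sym (count-between-sized (triple a b x) (N[_] G a) t
                 (triple-⊆ (∈N[]-self G a) (adj⇒∈N[] G a~b) (adj⇒∈N[] G a~x))
                 (subst (_≤ t) (sym ∣triple∣≡3) t≥3)))
          (C-pos (∸-monoˡ-≤ ∣ triple a b x ∣ (subst (t ≤_) (sym (∣N[]∣ G a)) load≡1⇒t≤suc-deg)))
      ... | T , _ , T-between = T , T-between

    -- Load 1 makes every t-subset between {a, b} and N[a] a clique; take one that also contains x.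
    load≡1⇒closed : 3 ≤ t → ∀ {x} → adj G a x ≡ true → x ≢ b → adj G b x ≡ true
    load≡1⇒closed t≥3 {x} a~x x≢b with extend-triple t≥3 a~x x≢b
    ... | T , T-between with onEdge⇒ a b T (between⇒onEdge T
                               (between-antimono (triple a b x) (N[_] G a) t T (pair⊆triple a b x) T-between))
    ...   | clique , _ , _ , b∈T = isClique⇒adj G T clique b∈T x∈T (x≢b ∘ sym)
      where
      x∈T : lookup T x ≡ true
      x∈T = ⊆-lookup (between-⊇ (triple a b x) (N[_] G a) t T T-between) x (∈tripleʳ a b x)

  module _ (c : Fin n → Fin n) (c-adj : ∀ u v → (adj G u v ≡ true) ⇔ ((u ≢ v) × (c u ≡ c v)))
           {a b : Fin n} (a~b : adj G a b ≡ true) where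
    open Equivalence

    labelled-between⇒onEdge : ∀ T → between (pair a b) (N[_] G a) t T ≡ true → onEdge a b T ≡ true
    labelled-between⇒onEdge T T-between =
      ∧-intro (∧-intro clique size) (∧-intro (member a (∈pairˡ a b)) (member b (∈pairʳ a b)))
      where
      member : ∀ i → lookup (pair a b) i ≡ true → lookup T i ≡ true
      member = ⊆-lookup (between-⊇ (pair a b) (N[_] G a) t T T-between)
      label : ∀ {u} → lookup T u ≡ true → c u ≡ c a
      label {u} u∈T = ∈N[]⇒same-label G c c-adj (⊆-lookup (between-⊆ (pair a b) (N[_] G a) t T T-between) u u∈T)
      clique : isCliqueSet G T ≡ true
      clique = isClique-intro G T λ u v u∈T v∈T u≢v → from (c-adj u v) (u≢v , trans (label u∈T) (sym (label v∈T)))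
      size : ⌊ ∣ T ∣ ℕ.≟ t ⌋ ≡ true
      size = ∧-elimʳ (pair a b ⊆ᵇ T) (∧-elimʳ (T ⊆ᵇ N[_] G a) T-between)

    labelled-denominator : ∀ T → onEdge a b T ≡ true → denominator T ≡ cliqueBound a
    labelled-denominator T on with onEdge⇒ a b T on
    ... | clique , _ , a∈T , _ =
      cong (λ d → (d ∸ 1) C (t ∸ 2)) (≤-antisym (theta≤ G T λ v v∈T → ≤-reflexive (same-deg v∈T)) (deg≤theta G T a∈T))
      where
      same-deg : ∀ {v} → lookup T v ≡ true → deg G v ≡ deg G a
      same-deg {v} v∈T =
        same-label⇒same-deg G c c-adj (∈N[]⇒same-label G c c-adj (⊆-lookup (clique⊆N[] G T clique a∈T) v v∈T))

  union⇒load≡1 : 2 ≤ t → IsUnionOfCliques t G → ∀ {a b} → adj G a b ≡ true → load a b ≡ 1ℚ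
  union⇒load≡1 t≥2 (c , c-adj , sizes) {a} {b} a~b =
    ∑-if-recip-≡1 (allSubsets n) (onEdge a b) denominator (cliqueBound a)
      (C-pos (∸-monoˡ-≤ 2 t≤suc-deg))
      (trans (count-cong (allSubsets n) (λ T → ≡-by-⇔ (onEdge⇒between a~b T) (labelled-between⇒onEdge c c-adj a~b T)))
             (count-between-edge a~b t≥2))
      (labelled-denominator c c-adj a~b)
    where
    t≤suc-deg : t ≤ suc (deg G a)
    t≤suc-deg with sizes a
    ... | inj₂ t≤size = subst (t ≤_) (componentSize≡suc-deg G c c-adj a) t≤size
    ... | inj₁ size≡1 = ⊥-elim (<-irrefl refl
          (subst (2 ≤_) (trans (sym (componentSize≡suc-deg G c c-adj a)) size≡1) (2≤∣N[]∣ G a~b)))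

-- Double counting

module _ {n} (G : Graph n) (t : ℕ) where

  edge : Fin n → Fin n → Bool
  edge u v = ⌊ u Fin.<? v ⌋ ∧ adj G u v

  overEdges : (Fin n → Fin n → ℚ) → ℚ
  overEdges f = ∑[ u ∈ allFin n ] ∑[ v ∈ allFin n ] (if edge u v then f u v else 0ℚ)

  fromℕ-numEdges : fromℕ (numEdges G) ≡ overEdges (λ _ _ → 1ℚ)
  fromℕ-numEdges = trans (fromℕ-∑ (allFin n) (λ u → count (edge u) (allFin n))) (∑-cong (allFin n) λ u →
    trans (sym (ℚ.*-identityʳ _)) (sym (∑-indicator (allFin n) (edge u) 1ℚ)))

  ∑-overEdges : (xs : List (Subset n)) (g : Subset n → Fin n → Fin n → ℚ) →
                ∑[ T ∈ xs ] overEdges (g T) ≡ overEdges (λ u v → ∑[ T ∈ xs ] g T u v)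
  ∑-overEdges xs g = begin
    ∑[ T ∈ xs ] ∑[ u ∈ allFin n ] ∑[ v ∈ allFin n ] (if edge u v then g T u v else 0ℚ)
      ≡⟨ ∑-comm xs (allFin n) _ ⟩
    ∑[ u ∈ allFin n ] ∑[ T ∈ xs ] ∑[ v ∈ allFin n ] (if edge u v then g T u v else 0ℚ)
      ≡⟨ ∑-cong (allFin n) (λ u → ∑-comm xs (allFin n) _) ⟩
    ∑[ u ∈ allFin n ] ∑[ v ∈ allFin n ] ∑[ T ∈ xs ] (if edge u v then g T u v else 0ℚ)
      ≡⟨ ∑-cong (allFin n) (λ u → ∑-cong (allFin n) λ v → ∑-pull-if xs (edge u v) (λ T → g T u v)) ⟩
    overEdges (λ u v → ∑[ T ∈ xs ] g T u v) ∎
    where open ≡-Reasoning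

  clique-contribution : ∀ T (w : ℚ) →
    (if isKt G t T then fromℕ (t C 2) *ℚ w else 0ℚ) ≡ overEdges (λ u v → if onEdge G t u v T then w else 0ℚ)
  clique-contribution T w with isKt G t T in Kt
  ... | false = sym (trans (∑-cong (allFin n) λ u → trans (∑-cong (allFin n) λ v → if-eta (edge u v)) (∑-zero (allFin n)))
                           (∑-zero (allFin n)))
  ... | true  = sym (begin
    overEdges (λ u v → if lookup T u ∧ lookup T v then w else 0ℚ)
      ≡⟨ ∑-cong (allFin n) (λ u → trans (∑-cong (allFin n) (entry u)) (∑-indicator (allFin n) _ w)) ⟩
    ∑[ u ∈ allFin n ] (fromℕ (pairsIn T u) *ℚ w)
      ≡⟨ ∑-*ʳ (allFin n) (λ u → fromℕ (pairsIn T u)) w ⟩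
    ∑[ u ∈ allFin n ] fromℕ (pairsIn T u) *ℚ w
      ≡⟨ cong (_*ℚ w) (sym (fromℕ-∑ (allFin n) (pairsIn T))) ⟩
    fromℕ (pairCount T) *ℚ w
      ≡⟨ cong (λ k → fromℕ k *ℚ w) (trans (pairCount≡C2 T) (cong (_C 2) ∣T∣≡t)) ⟩
    fromℕ (t C 2) *ℚ w ∎)
    where
    open ≡-Reasoning
    clique : isCliqueSet G T ≡ true
    clique = ∧-elimˡ (isCliqueSet G T) Kt
    ∣T∣≡t : ∣ T ∣ ≡ t
    ∣T∣≡t = ⌊⌋-true⁻ (∣ T ∣ ℕ.≟ t) (∧-elimʳ (isCliqueSet G T) Kt)
    entry : ∀ u v → (if edge u v then (if lookup T u ∧ lookup T v then w else 0ℚ) else 0ℚ)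
                  ≡ (if ⌊ u Fin.<? v ⌋ ∧ (lookup T u ∧ lookup T v) then w else 0ℚ)
    entry u v with ⌊ u Fin.<? v ⌋ in u<v | lookup T u in u∈T | lookup T v in v∈T
    ... | false | _     | _     = refl
    ... | true  | false | _     = if-eta (adj G u v)
    ... | true  | true  | false = if-eta (adj G u v)
    ... | true  | true  | true  rewrite isClique⇒adj G T clique u∈T v∈T (<⇒≢ (⌊⌋-true⁻ (u Fin.<? v) u<v)) = refl

  double-counting : fromℕ (t C 2) *ℚ cliqueSum G t ≡ overEdges (load G t)
  double-counting = begin
    fromℕ (t C 2) *ℚ ∑[ T ∈ cliques G t ] w T
      ≡⟨ *-distribˡ-∑ (fromℕ (t C 2)) (cliques G t) w ⟩
    ∑[ T ∈ cliques G t ] (fromℕ (t C 2) *ℚ w T)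
      ≡⟨ ∑-filter (λ T → isKt G t T Bool.≟ true) (allSubsets n) _ ⟩
    ∑[ T ∈ allSubsets n ] (if does (isKt G t T Bool.≟ true) then fromℕ (t C 2) *ℚ w T else 0ℚ)
      ≡⟨ ∑-cong (allSubsets n) (λ T → trans (cong (if_then fromℕ (t C 2) *ℚ w T else 0ℚ) (does-≟-true (isKt G t T)))
                                           (clique-contribution T (w T))) ⟩
    ∑[ T ∈ allSubsets n ] overEdges (λ u v → if onEdge G t u v T then w T else 0ℚ)
      ≡⟨ ∑-overEdges (allSubsets n) _ ⟩
    overEdges (load G t) ∎
    where
    open ≡-Reasoning
    w : Subset n → ℚ
    w T = recip (denominator G t T)

  module _ {f g : Fin n → Fin n → ℚ} (f≤g : ∀ u v → edge u v ≡ true → f u v ≤ℚ g u v) where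

    on-edge-≤ : ∀ u v → (if edge u v then f u v else 0ℚ) ≤ℚ (if edge u v then g u v else 0ℚ)
    on-edge-≤ u v with edge u v in uv
    ... | true  = f≤g u v uv
    ... | false = ℚ.≤-refl

    overEdges-mono : overEdges f ≤ℚ overEdges g
    overEdges-mono = ∑-mono-≤ (allFin n) (λ u → ∑-mono-≤ (allFin n) (on-edge-≤ u))

    overEdges-≡⇔ : (overEdges f ≡ overEdges g) ⇔ (∀ u v → edge u v ≡ true → f u v ≡ g u v)
    overEdges-≡⇔ = mk⇔ pointwise summed
      where
      pointwise : overEdges f ≡ overEdges g → ∀ u v → edge u v ≡ true → f u v ≡ g u v
      pointwise eq u v uv = subst (λ b → (if b then f u v else 0ℚ) ≡ (if b then g u v else 0ℚ)) uv
        (∑-mono-≤-equality (allFin n) (on-edge-≤ u)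
          (∑-mono-≤-equality (allFin n) (λ u → ∑-mono-≤ (allFin n) (on-edge-≤ u)) eq u (∈-allFin u)) v (∈-allFin v))
      summed : (∀ u v → edge u v ≡ true → f u v ≡ g u v) → overEdges f ≡ overEdges g
      summed f≡g = ∑-cong (allFin n) λ u → ∑-cong (allFin n) λ v → on-edge u v
        where
        on-edge : ∀ u v → (if edge u v then f u v else 0ℚ) ≡ (if edge u v then g u v else 0ℚ)
        on-edge u v with edge u v in uv
        ... | true  = f≡g u v uv
        ... | false = refl

  load-sym : ∀ a b → load G t a b ≡ load G t b a
  load-sym a b = ∑-cong (allSubsets n) λ T →
    cong (λ x → if isKt G t T ∧ x then recip (denominator G t T) else 0ℚ) (∧-comm (lookup T a) (lookup T b))

  edges⇔adjacent : ∀ (P : Fin n → Fin n → Set) → (∀ a b → P a b → P b a) →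
                   (∀ u v → edge u v ≡ true → P u v) ⇔ (∀ {a b} → adj G a b ≡ true → P a b)
  edges⇔adjacent P P-sym = mk⇔ on-adjacent (λ on-adj u v uv → on-adj (∧-elimʳ ⌊ u Fin.<? v ⌋ uv))
    where
    on-adjacent : (∀ u v → edge u v ≡ true → P u v) → ∀ {a b} → adj G a b ≡ true → P a b
    on-adjacent on-edges {a} {b} a~b with <-cmp a b
    ... | tri< a<b _ _ = on-edges a b (∧-intro (⌊⌋-true (a Fin.<? b) a<b) a~b)
    ... | tri≈ _ a≡b _ = ⊥-elim (adj⇒≢ G a~b a≡b)
    ... | tri> _ _ b<a = P-sym b a (on-edges b a (∧-intro (⌊⌋-true (b Fin.<? a) b<a) (adj-sym G a~b)))

  cliqueSum≤edgeBound : 2 ≤ t → cliqueSum G t ≤ℚ edgeBound G t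
  cliqueSum≤edgeBound t≥2 = ≤-*recip (C-pos t≥2) (begin
    fromℕ (t C 2) *ℚ cliqueSum G t ≡⟨ double-counting ⟩
    overEdges (load G t)          ≤⟨ overEdges-mono (λ u v uv → load≤1 G t (∧-elimʳ ⌊ u Fin.<? v ⌋ uv) t≥2) ⟩
    overEdges (λ _ _ → 1ℚ)        ≡⟨ fromℕ-numEdges ⟨
    fromℕ (numEdges G)            ∎)
    where open ℚ.≤-Reasoning

  cliqueSum≡edgeBound⇔ : 2 ≤ t → (cliqueSum G t ≡ edgeBound G t) ⇔ (∀ {a b} → adj G a b ≡ true → load G t a b ≡ 1ℚ)
  cliqueSum≡edgeBound⇔ t≥2 = begin
    cliqueSum G t ≡ edgeBound G t
      ≈⟨ ⇔-sym (*≡⇔≡*recip (C-pos t≥2)) ⟩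
    fromℕ (t C 2) *ℚ cliqueSum G t ≡ fromℕ (numEdges G)
      ≈⟨ mk⇔ (λ eq → trans (sym double-counting) (trans eq fromℕ-numEdges))
             (λ eq → trans double-counting (trans eq (sym fromℕ-numEdges))) ⟩
    overEdges (load G t) ≡ overEdges (λ _ _ → 1ℚ)
      ≈⟨ overEdges-≡⇔ (λ u v uv → load≤1 G t (∧-elimʳ ⌊ u Fin.<? v ⌋ uv) t≥2) ⟩
    (∀ u v → edge u v ≡ true → load G t u v ≡ 1ℚ)
      ≈⟨ edges⇔adjacent (λ a b → load G t a b ≡ 1ℚ) (λ a b eq → trans (load-sym b a) eq) ⟩
    (∀ {a b} → adj G a b ≡ true → load G t a b ≡ 1ℚ) ∎
    where open SetoidReasoning (⇔-setoid 0ℓ)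

  loads≡1⇒union : 3 ≤ t → (∀ {a b} → adj G a b ≡ true → load G t a b ≡ 1ℚ) → IsUnionOfCliques t G
  loads≡1⇒union t≥3 loads≡1 =
    leader G closed , adj⇔same-leader G closed ,
    component-sizes G (leader G closed) (adj⇔same-leader G closed) (λ a~b → load≡1⇒t≤suc-deg G t t≥2 a~b (loads≡1 a~b))
    where
    t≥2 : 2 ≤ t
    t≥2 = ≤-trans (n≤1+n 2) t≥3
    closed : ∀ {a b x} → adj G a b ≡ true → adj G a x ≡ true → x ≢ b → adj G b x ≡ true
    closed a~b = load≡1⇒closed G t t≥2 a~b (loads≡1 a~b) t≥3

corollary5p3 : ∀ {n} (G : Graph n) (t : ℕ) → 2 ≤ t →
    (cliqueSum G t ≤ℚ edgeBound G t)
    × (3 ≤ t → ((cliqueSum G t ≡ edgeBound G t) ⇔ IsUnionOfCliques t G))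
corollary5p3 G t t≥2 = cliqueSum≤edgeBound G t t≥2 , λ t≥3 → mk⇔
  (λ equality → loads≡1⇒union G t t≥3 (Equivalence.to (cliqueSum≡edgeBound⇔ G t t≥2) equality))
  (λ union → Equivalence.from (cliqueSum≡edgeBound⇔ G t t≥2) (union⇒load≡1 G t t≥2 union))
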